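{- The theory $\mathbf{K}\cup\mathbf{KK}$ is not closed generic.
   Context: Fix a nonempty set of symbols called propositional atoms and a symbol $\mathrm{K}$ which is not a propositional atom. Formulas are defined recursively: every propositional atom is a formula; if $\varphi,\psi$ are formulas then so are $\neg\varphi$, $(\varphi\wedge\psi)$, $(\varphi\vee\psi)$, $(\varphi\rightarrow\psi)$; if $\varphi$ is a formula then so is $\mathrm{K}(\varphi)$. A formula is basic if it is a propositional atom or of the form $\mathrm{K}\varphi$. A theory is a set of formulas. A model is a function assigning a truth value to every basic formula; truth $\mathscr M\models\varphi$ of an arbitrary formula is defined from the values of basic formulas by the classical truth tables (formulas $\mathrm{K}\varphi$ are treated like atoms). $\mathscr M\models T$ means $\mathscr M\models\varphi$ for all $\varphi\in T$; $T\models\varphi$ means every model of $T$ satisfies $\varphi$. A theory $T$ is closed if $\varphi\in T$ implies $\mathrm{K}\varphi\in T$. $\mathbf{K}=\{\mathrm{K}(\varphi\rightarrow\psi)\rightarrow(\mathrm{K}\varphi\rightarrow\mathrm{K}\psi)\}$; $\mathbf{KK}=\{\mathrm{K}\varphi\rightarrow\mathrm{K}\mathrm{K}\varphi\}$ (all formulas of these forms). For a theory $T$ and a set $S$ of propositional atoms, $\mathscr M_{T,S}$ is the model with $\mathscr M_{T,S}\models p$ iff $p\in S$ for atoms $p$, and $\mathscr M_{T,S}\models\mathrm{K}\varphi$ iff $T\models\varphi$. A theory $T$ is closed generic if for every set $S$ of propositional atoms and every closed theory $T'\supseteq T$, $\mathscr M_{T',S}\models T$. -}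

module Defs where

open import Data.Bool using (Bool; true; false; not; _∧_; _∨_)
open import Data.Product using (Σ; ∃; _×_; _,_)
open import Data.Sum using (_⊎_)
open import Relation.Binary.PropositionalEquality using (_≡_)
open import Function.Bundles using (_⇔_)

data Formula (A : Set) : Set where
  atom : A → Formula A
  ¬'_  : Formula A → Formula A
  _∧'_ : Formula A → Formula A → Formula A
  _∨'_ : Formula A → Formula A → Formula A
  _⇒'_ : Formula A → Formula A → Formula A
  K    : Formula A → Formula A

infixr 5 _⇒'_

-- A model assigns a truth value to every basic formula: basic formulas are
-- the atoms and the formulas of the form K φ, so a model is given by its
-- values on atoms and its values on formulas K φ (indexed by φ).
record Model (A : Set) : Set where
  constructor model
  field
    valAtom : A → Bool
    valK    : Formula A → Bool

open Model public

eval : {A : Set} → Model A → Formula A → Bool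
eval M (atom p) = valAtom M p
eval M (¬' φ)   = not (eval M φ)
eval M (φ ∧' ψ) = eval M φ ∧ eval M ψ
eval M (φ ∨' ψ) = eval M φ ∨ eval M ψ
eval M (φ ⇒' ψ) = not (eval M φ) ∨ eval M ψ
eval M (K φ)    = valK M φ

_⊨_ : {A : Set} → Model A → Formula A → Set
M ⊨ φ = eval M φ ≡ true

Theory : Set → Set₁
Theory A = Formula A → Set

_⊨ᵀ_ : {A : Set} → Model A → Theory A → Set
M ⊨ᵀ T = ∀ φ → T φ → M ⊨ φ

_⊩_ : {A : Set} → Theory A → Formula A → Set
T ⊩ φ = ∀ M → M ⊨ᵀ T → M ⊨ φ

_⊆ᵀ_ : {A : Set} → Theory A → Theory A → Set
T ⊆ᵀ T' = ∀ φ → T φ → T' φ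

Closed : {A : Set} → Theory A → Set
Closed T = ∀ φ → T φ → T (K φ)

AxK : {A : Set} → Theory A
AxK χ = ∃ λ φ → ∃ λ ψ → χ ≡ (K (φ ⇒' ψ) ⇒' (K φ ⇒' K ψ))

AxKK : {A : Set} → Theory A
AxKK χ = ∃ λ φ → χ ≡ (K φ ⇒' K (K φ))

K∪KK : {A : Set} → Theory A
K∪KK χ = AxK χ ⊎ AxKK χ

-- M is the model M_{T,S}: S is a set of atoms given by its characteristic
-- function; M ⊨ p iff p ∈ S, and M ⊨ K φ iff T ⊨ φ.
IsM[_,_] : {A : Set} → Theory A → (A → Bool) → Model A → Set
IsM[ T , S ] M = (∀ p → valAtom M p ≡ S p) × (∀ φ → (valK M φ ≡ true) ⇔ (T ⊩ φ))

-- T is closed generic: for every set S of atoms and every closed T' ⊇ T,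
-- M_{T',S} ⊨ T.  (M_{T',S} is uniquely determined by IsM; we phrase
-- "M_{T',S} ⊨ T" as "the model M_{T',S} exists and satisfies T".)
ClosedGeneric : {A : Set} → Theory A → Set₁
ClosedGeneric {A} T =
  (S : A → Bool) (T' : Theory A) → T ⊆ᵀ T' → Closed T' →
  Σ (Model A) λ M → IsM[ T' , S ] M × (M ⊨ᵀ T)

-- Every model of the form M_{T,S} satisfying KK makes the consequences of T
-- closed under K: from T ⊨ τ we get M ⊨ Kτ, hence M ⊨ KKτ, hence T ⊨ Kτ.
-- Apply this to T = the K-closure of K ∪ KK and the tautology τ = p ∨ ¬p.
-- It remains to see that this T does not entail Kτ, which is witnessed by a
-- model whose knowledge is not closed under tautologies.
{-# OPTIONS --safe #-}
module Submission where

open import Defs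
open import Relation.Nullary using (¬_)
open import Data.Bool using (Bool; true; false; not; _∨_)
open import Data.Bool.Properties using (∨-inverseˡ; ∨-inverseʳ; ∨-zeroʳ)
open import Data.Nat using (ℕ; zero; suc)
open import Data.Product using (∃; _×_; _,_)
open import Data.Sum using (inj₁; inj₂)
open import Relation.Binary.PropositionalEquality using (_≡_; refl)
open import Function.Bundles using (Equivalence)

module _ {A : Set} where

  K^ : ℕ → Formula A → Formula A
  K^ zero    φ = φ
  K^ (suc n) φ = K (K^ n φ)

  K-closure : Theory A → Theory A
  K-closure T χ = ∃ λ n → ∃ λ φ → T φ × χ ≡ K^ n φ

  ⊆-K-closure : (T : Theory A) → T ⊆ᵀ K-closure T
  ⊆-K-closure T φ Tφ = zero , φ , Tφ , refl

  K-closure-closed : (T : Theory A) → Closed (K-closure T)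
  K-closure-closed T _ (n , φ , Tφ , refl) = suc n , φ , Tφ , refl

  ⊨-mp : {M : Model A} {φ ψ : Formula A} → M ⊨ (φ ⇒' ψ) → M ⊨ φ → M ⊨ ψ
  ⊨-mp ⊨φ⇒ψ ⊨φ rewrite ⊨φ = ⊨φ⇒ψ

  ⊩-K-closed : {T : Theory A} {S : A → Bool} {M : Model A} →
               IsM[ T , S ] M → M ⊨ᵀ AxKK → ∀ {φ} → T ⊩ φ → T ⊩ K φ
  ⊩-K-closed {M = M} (_ , knows) M⊨KK {φ} T⊩φ =
    Equivalence.to (knows (K φ))
      (⊨-mp {M} {K φ} {K (K φ)} (M⊨KK _ (φ , refl)) (Equivalence.from (knows φ) T⊩φ))

  excluded-middle : A → Formula A
  excluded-middle p = atom p ∨' (¬' atom p)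

  ⊩-excluded-middle : (T : Theory A) (p : A) → T ⊩ excluded-middle p
  ⊩-excluded-middle T p M _ = ∨-inverseʳ (valAtom M p)

  -- Evaluates φ with every K-formula true, but rejects everything built
  -- with ¬, ∧ or ∨; in particular it rejects atom p ∨ ¬ atom p.
  implicationalTruth : Formula A → Bool
  implicationalTruth (K _)    = true
  implicationalTruth (φ ⇒' ψ) = not (implicationalTruth φ) ∨ implicationalTruth ψ
  implicationalTruth _        = false

  N : Model A
  N = model (λ _ → false) implicationalTruth

  N⊨K∪KK : N ⊨ᵀ K∪KK
  N⊨K∪KK _ (inj₁ (φ , ψ , refl)) =
    ∨-inverseˡ (not (implicationalTruth φ) ∨ implicationalTruth ψ)
  N⊨K∪KK _ (inj₂ (φ , refl)) = ∨-zeroʳ (not (implicationalTruth φ))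

  N⊨K-closure-K∪KK : N ⊨ᵀ K-closure K∪KK
  N⊨K-closure-K∪KK _ (zero , α , ax , refl)                       = N⊨K∪KK α ax
  N⊨K-closure-K∪KK _ (suc zero , _ , inj₁ (_ , _ , refl) , refl) = refl
  N⊨K-closure-K∪KK _ (suc zero , _ , inj₂ (_ , refl) , refl)     = refl
  N⊨K-closure-K∪KK _ (suc (suc _) , _ , _ , refl)                = refl

  K-closure-K∪KK-⊮-K-excluded-middle :
    (p : A) → ¬ (K-closure K∪KK ⊩ K (excluded-middle p))
  K-closure-K∪KK-⊮-K-excluded-middle p entails with entails N N⊨K-closure-K∪KK
  ... | ()

theorem25 : (A : Set) → A → ¬ ClosedGeneric (K∪KK {A})
theorem25 A p closedGeneric
  with closedGeneric (λ _ → true) (K-closure K∪KK)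
         (⊆-K-closure K∪KK) (K-closure-closed K∪KK)
... | M , isM , M⊨K∪KK =
  K-closure-K∪KK-⊮-K-excluded-middle p
    (⊩-K-closed isM (λ χ χ∈KK → M⊨K∪KK χ (inj₂ χ∈KK))
       (⊩-excluded-middle (K-closure K∪KK) p))
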